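{- For integers $n,r\ge 0$ and $0\le k\le n$, \[ u_r(n,n-k)=\sum_{i=0}^{k}\sum_{j=-i}^{i}(-1)^{k+j}\binom{n-i}{k-i}\,s(n,n-i+j)\,s(n,n-i-j)\,r^{k-i}. \]
   Context: For a nonnegative integer $r$, the numbers $u_r(n,k)$ ($n,k\ge 0$ integers) are defined by $u_r(n,k)=u_r(n-1,k-1)-((n-1)^2+r)\,u_r(n-1,k)$ for $n\ge k\ge 1$, with $u_r(n,0)=(-1)^n\prod_{i=0}^{n-1}(i^2+r)$, $u_r(0,k)=\delta_{k0}$, and $u_r(n,k)=0$ for $k>n$. Here $s(n,m)$ are the (signed) Stirling numbers of the first kind, defined by $x(x-1)\cdots(x-n+1)=\sum_{m=0}^{n}s(n,m)x^m$, with $s(n,m)=0$ for $m>n$ or $m<0$; also $0^0=1$. -}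

module Defs where

open import Data.Nat as ℕ using (ℕ; zero; suc)
open import Data.Integer using (ℤ; +_; -[1+_]; _+_; _*_; _-_; -_; 0ℤ; 1ℤ)
open import Data.Nat.Combinatorics using (_C_)
open import Data.Bool using (true; false)

sgn : ℕ → ℤ
sgn zero = 1ℤ
sgn (suc n) = - sgn n

-- signed Stirling numbers of the first kind s(n,m), m ∈ ℕ:
-- x(x-1)...(x-n+1) = Σ_m s(n,m) x^m, so s(n+1,m) = s(n,m-1) - n s(n,m)
stirling1 : ℕ → ℕ → ℤ
stirling1 zero zero = 1ℤ
stirling1 zero (suc m) = 0ℤ
stirling1 (suc n) zero = - (+ n) * stirling1 n zero
stirling1 (suc n) (suc m) = stirling1 n m - (+ n) * stirling1 n (suc m)

s : ℕ → ℤ → ℤ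
s n (+ m) = stirling1 n m
s n -[1+ m ] = 0ℤ

prodSq : ℕ → ℕ → ℕ
prodSq r zero = 1
prodSq r (suc n) = prodSq r n ℕ.* (n ℕ.* n ℕ.+ r)

u : ℕ → ℕ → ℕ → ℤ
u r zero zero = 1ℤ
u r zero (suc k) = 0ℤ
u r (suc n) zero = sgn (suc n) * + prodSq r (suc n)
u r (suc n) (suc k) with suc k ℕ.≤ᵇ suc n
... | true  = u r n k - (+ (n ℕ.* n ℕ.+ r)) * u r n (suc k)
... | false = 0ℤ

Σ≤ : ℕ → (ℕ → ℤ) → ℤ
Σ≤ zero f = f zero
Σ≤ (suc n) f = Σ≤ n f + f (suc n)

Σsym : ℕ → (ℤ → ℤ) → ℤ
Σsym i g = Σ≤ (i ℕ.+ i) (λ t → g (+ t - + i))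

sgnℤ : ℤ → ℤ
sgnℤ (+ j) = sgn j
sgnℤ -[1+ j ] = sgn (suc j)

rhs : ℕ → ℕ → ℕ → ℤ
rhs r n k = Σ≤ k (λ i → Σsym i (λ j →
  sgn k * sgnℤ j * (+ ((n ℕ.∸ i) C (k ℕ.∸ i)))
    * s n (+ (n ℕ.∸ i) + j) * s n (+ (n ℕ.∸ i) - j) * (+ (r ℕ.^ (k ℕ.∸ i)))))

-- u_r(n,·) lists the coefficients of ∏_{i<n} (x - i² - r) = q(x - r), where q = ∏_{i<n} (x - i²); hence
-- u_r(n,l) = Σ_m C(m,l) (-r)^(m-l) u_0(n,m). Since ∏_{i<n} (x² - i²) = (-1)^n (x)_n (-x)_n, comparing coefficients
-- gives u_0(n,l) = (-1)^(n+l) Σ_{|j|≤n} (-1)^j s(n,l+j) s(n,l-j). This is proved from the recurrences: expanding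
-- s(n+1,·) = s(n,·-1) - n s(n,·) in both factors leaves cross terms whose sum over j telescopes.
-- Finally, with m = n - i, the binomial kills the terms with i > k, and s(n, n-i±j) those with |j| > i.

module Submission where

open import Defs
open import Data.Nat using (ℕ; _≤_; _∸_)
open import Data.Integer using (ℤ)
open import Relation.Binary.PropositionalEquality using (_≡_)

open import Data.Nat as ℕ using (zero; suc; z≤n; s≤s; _<_)
import Data.Nat.Properties as ℕₚ
open import Data.Nat.Combinatorics using (_C_; nCk≡nC[n∸k]; nCk+nC[k+1]≡[n+1]C[k+1])
open import Data.Nat.Combinatorics.Specification using (k>n⇒nCk≡0)
open import Data.Integer using (_+_; _*_; _-_; -_; +_; -[1+_]; 0ℤ; 1ℤ)
import Data.Integer.Properties as ℤₚ
open import Data.Integer.Tactic.RingSolver using (solve-∀)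
open import Data.Bool using (true; false; T)
open import Data.Unit using (tt)
open import Data.Empty using (⊥-elim)
open import Data.Sum using (inj₁; inj₂)
open import Relation.Nullary using (yes; no)
open import Relation.Binary.PropositionalEquality using (refl; sym; trans; cong; cong₂; subst; module ≡-Reasoning)

open ≡-Reasoning

Σ≤-cong-≤ : ∀ N {f g : ℕ → ℤ} → (∀ i → i ≤ N → f i ≡ g i) → Σ≤ N f ≡ Σ≤ N g
Σ≤-cong-≤ zero e = e 0 z≤n
Σ≤-cong-≤ (suc N) e =
  cong₂ _+_ (Σ≤-cong-≤ N (λ i i≤N → e i (ℕₚ.m≤n⇒m≤1+n i≤N))) (e (suc N) ℕₚ.≤-refl)

Σ≤-cong : ∀ N {f g : ℕ → ℤ} → (∀ i → f i ≡ g i) → Σ≤ N f ≡ Σ≤ N g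
Σ≤-cong N e = Σ≤-cong-≤ N (λ i _ → e i)

Σ≤-zero : ∀ N {f : ℕ → ℤ} → (∀ i → f i ≡ 0ℤ) → Σ≤ N f ≡ 0ℤ
Σ≤-zero zero z = z 0
Σ≤-zero (suc N) z = cong₂ _+_ (Σ≤-zero N z) (z (suc N))

Σ≤-+ : ∀ N (f g : ℕ → ℤ) → Σ≤ N (λ i → f i + g i) ≡ Σ≤ N f + Σ≤ N g
Σ≤-+ zero f g = refl
Σ≤-+ (suc N) f g =
  trans (cong (_+ (f (suc N) + g (suc N))) (Σ≤-+ N f g))
        (interchange (Σ≤ N f) (Σ≤ N g) (f (suc N)) (g (suc N)))
  where
  interchange : ∀ a b c d → (a + b) + (c + d) ≡ (a + c) + (b + d)
  interchange = solve-∀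

Σ≤-*ˡ : ∀ N c (f : ℕ → ℤ) → Σ≤ N (λ i → c * f i) ≡ c * Σ≤ N f
Σ≤-*ˡ zero c f = refl
Σ≤-*ˡ (suc N) c f =
  trans (cong (_+ c * f (suc N)) (Σ≤-*ˡ N c f)) (sym (ℤₚ.*-distribˡ-+ c (Σ≤ N f) (f (suc N))))

Σ≤-linear : ∀ N c (f g : ℕ → ℤ) → Σ≤ N (λ i → f i + c * g i) ≡ Σ≤ N f + c * Σ≤ N g
Σ≤-linear N c f g = trans (Σ≤-+ N f (λ i → c * g i)) (cong (λ t → Σ≤ N f + t) (Σ≤-*ˡ N c g))

Σ≤-unfoldˡ : ∀ N (f : ℕ → ℤ) → Σ≤ (suc N) f ≡ f 0 + Σ≤ N (λ i → f (suc i))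
Σ≤-unfoldˡ zero f = refl
Σ≤-unfoldˡ (suc N) f =
  trans (cong (_+ f (suc (suc N))) (Σ≤-unfoldˡ N f))
        (ℤₚ.+-assoc (f 0) (Σ≤ N (λ i → f (suc i))) (f (suc (suc N))))

Σ≤-reverse : ∀ N (f : ℕ → ℤ) → Σ≤ N f ≡ Σ≤ N (λ i → f (N ∸ i))
Σ≤-reverse zero f = refl
Σ≤-reverse (suc N) f = begin
  Σ≤ N f + f (suc N)                           ≡⟨ ℤₚ.+-comm (Σ≤ N f) _ ⟩
  f (suc N) + Σ≤ N f                           ≡⟨ cong (λ t → f (suc N) + t) (Σ≤-reverse N f) ⟩
  f (suc N) + Σ≤ N (λ i → f (N ∸ i))           ≡⟨ Σ≤-unfoldˡ N (λ i → f (suc N ∸ i)) ⟨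
  Σ≤ (suc N) (λ i → f (suc N ∸ i))             ∎

Σ≤-vanishing-tail : ∀ {k} N (f : ℕ → ℤ) → k ≤ N → (∀ i → k < i → i ≤ N → f i ≡ 0ℤ) →
                    Σ≤ N f ≡ Σ≤ k f
Σ≤-vanishing-tail zero f z≤n _ = refl
Σ≤-vanishing-tail {k} (suc N) f k≤1+N z with ℕₚ.m≤n⇒m<n∨m≡n k≤1+N
... | inj₂ refl = refl
... | inj₁ (s≤s k≤N) = begin
  Σ≤ N f + f (suc N)
    ≡⟨ cong₂ _+_ (Σ≤-vanishing-tail N f k≤N (λ i k<i i≤N → z i k<i (ℕₚ.m≤n⇒m≤1+n i≤N)))
                 (z (suc N) (s≤s k≤N) ℕₚ.≤-refl) ⟩
  Σ≤ k f + 0ℤ         ≡⟨ ℤₚ.+-identityʳ _ ⟩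
  Σ≤ k f              ∎

Σsym-cong : ∀ w {f g : ℤ → ℤ} → (∀ j → f j ≡ g j) → Σsym w f ≡ Σsym w g
Σsym-cong w e = Σ≤-cong (w ℕ.+ w) (λ t → e (+ t - + w))

Σsym-*ˡ : ∀ w c (f : ℤ → ℤ) → Σsym w (λ j → c * f j) ≡ c * Σsym w f
Σsym-*ˡ w c f = Σ≤-*ˡ (w ℕ.+ w) c (λ t → f (+ t - + w))

Σsym-linear : ∀ w c (f g : ℤ → ℤ) → Σsym w (λ j → f j + c * g j) ≡ Σsym w f + c * Σsym w g
Σsym-linear w c f g = Σ≤-linear (w ℕ.+ w) c (λ t → f (+ t - + w)) (λ t → g (+ t - + w))

private
  shift-index : ∀ a b → (1ℤ + a) - (1ℤ + b) ≡ a - b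
  shift-index = solve-∀

Σsym-suc : ∀ w (g : ℤ → ℤ) → Σsym (suc w) g ≡ g -[1+ w ] + Σsym w g + g (+ suc w)
Σsym-suc w g = begin
  Σ≤ (suc w ℕ.+ suc w) h                            ≡⟨ cong (λ K → Σ≤ (suc K) h) (ℕₚ.+-suc w w) ⟩
  Σ≤ (suc (w ℕ.+ w)) h + h (suc (suc (w ℕ.+ w)))
    ≡⟨ cong (_+ h (suc (suc (w ℕ.+ w)))) (Σ≤-unfoldˡ (w ℕ.+ w) h) ⟩
  h 0 + Σ≤ (w ℕ.+ w) (λ t → h (suc t)) + h (suc (suc (w ℕ.+ w)))
    ≡⟨ cong₂ (λ S x → h 0 + S + x) (Σ≤-cong (w ℕ.+ w) (λ t → cong g (shift-index (+ t) (+ w))))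
                                   (cong g (top (+ w))) ⟩
  g -[1+ w ] + Σsym w g + g (+ suc w)               ∎
  where
  h : ℕ → ℤ
  h t = g (+ t - + suc w)
  top : ∀ a → (1ℤ + (1ℤ + (a + a))) - (1ℤ + a) ≡ 1ℤ + a
  top = solve-∀

Σsym-shift : ∀ w (g : ℤ → ℤ) → Σsym w (λ j → g (j - 1ℤ)) + g (+ w) ≡ g -[1+ w ] + Σsym w g
Σsym-shift w g = begin
  Σsym w (λ j → g (j - 1ℤ)) + g (+ w)
    ≡⟨ cong₂ _+_ (Σ≤-cong (w ℕ.+ w) (λ t → cong g (pred-index (+ t) (+ w)))) (cong g (top (+ w))) ⟩
  Σ≤ (suc (w ℕ.+ w)) h                         ≡⟨ Σ≤-unfoldˡ (w ℕ.+ w) h ⟩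
  h 0 + Σ≤ (w ℕ.+ w) (λ t → h (suc t))
    ≡⟨ cong (λ S → h 0 + S) (Σ≤-cong (w ℕ.+ w) (λ t → cong g (shift-index (+ t) (+ w)))) ⟩
  g -[1+ w ] + Σsym w g                        ∎
  where
  h : ℕ → ℤ
  h t = g (+ t - + suc w)
  pred-index : ∀ a b → (a - b) - 1ℤ ≡ a - (1ℤ + b)
  pred-index = solve-∀
  top : ∀ a → a ≡ (1ℤ + (a + a)) - (1ℤ + a)
  top = solve-∀

Σsym-telescope : ∀ w (g : ℤ → ℤ) → Σsym w (λ j → g j - g (j - 1ℤ)) ≡ g (+ w) - g -[1+ w ]
Σsym-telescope w g = begin
  Σsym w (λ j → g j - g (j - 1ℤ))             ≡⟨ Σsym-cong w (λ j → sub-as-scale (g j) (g (j - 1ℤ))) ⟩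
  Σsym w (λ j → g j + - 1ℤ * g (j - 1ℤ))      ≡⟨ Σsym-linear w (- 1ℤ) g (λ j → g (j - 1ℤ)) ⟩
  S + - 1ℤ * S′                               ≡⟨ expand S S′ a b ⟩
  (a + S) - (S′ + b) + b - a                  ≡⟨ cong (λ t → t - (S′ + b) + b - a) (Σsym-shift w g) ⟨
  (S′ + b) - (S′ + b) + b - a                 ≡⟨ cancel (S′ + b) b a ⟩
  b - a                                       ∎
  where
  S S′ : ℤ
  S = Σsym w g
  S′ = Σsym w (λ j → g (j - 1ℤ))
  a b : ℤ
  a = g -[1+ w ]
  b = g (+ w)
  expand : ∀ S S′ a b → S + - 1ℤ * S′ ≡ (a + S) - (S′ + b) + b - a
  expand = solve-∀
  cancel : ∀ x b a → x - x + b - a ≡ b - a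
  cancel = solve-∀
  sub-as-scale : ∀ a b → a - b ≡ a + - 1ℤ * b
  sub-as-scale = solve-∀

Σsym-narrow : ∀ {i} w (g : ℤ → ℤ) → i ≤ w →
              (∀ v → i ≤ v → g -[1+ v ] ≡ 0ℤ) → (∀ v → i ≤ v → g (+ suc v) ≡ 0ℤ) →
              Σsym w g ≡ Σsym i g
Σsym-narrow zero g z≤n _ _ = refl
Σsym-narrow {i} (suc w) g i≤1+w zˡ zʳ with ℕₚ.m≤n⇒m<n∨m≡n i≤1+w
... | inj₂ refl = refl
... | inj₁ (s≤s i≤w) = begin
  Σsym (suc w) g                         ≡⟨ Σsym-suc w g ⟩
  g -[1+ w ] + Σsym w g + g (+ suc w)    ≡⟨ cong₂ (λ x y → x + Σsym w g + y) (zˡ w i≤w) (zʳ w i≤w) ⟩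
  0ℤ + Σsym w g + 0ℤ                     ≡⟨ drop-zeros (Σsym w g) ⟩
  Σsym w g                               ≡⟨ Σsym-narrow w g i≤w zˡ zʳ ⟩
  Σsym i g                               ∎
  where
  drop-zeros : ∀ x → 0ℤ + x + 0ℤ ≡ x
  drop-zeros = solve-∀

sgn-+ : ∀ a b → sgn (a ℕ.+ b) ≡ sgn a * sgn b
sgn-+ zero b = sym (ℤₚ.*-identityˡ _)
sgn-+ (suc a) b = trans (cong -_ (sgn-+ a b)) (ℤₚ.neg-distribˡ-* (sgn a) (sgn b))

sgn-*-sgn : ∀ a → sgn a * sgn a ≡ 1ℤ
sgn-*-sgn zero = refl
sgn-*-sgn (suc a) = trans (neg-*-neg (sgn a)) (sgn-*-sgn a)
  where
  neg-*-neg : ∀ x → (- x) * (- x) ≡ x * x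
  neg-*-neg = solve-∀

sgn-+-twice : ∀ a b → sgn (a ℕ.+ b ℕ.+ a) ≡ sgn b
sgn-+-twice a b = begin
  sgn (a ℕ.+ b ℕ.+ a)          ≡⟨ trans (sgn-+ (a ℕ.+ b) a) (cong (_* sgn a) (sgn-+ a b)) ⟩
  sgn a * sgn b * sgn a        ≡⟨ pair-up (sgn a) (sgn b) ⟩
  (sgn a * sgn a) * sgn b      ≡⟨ cong (_* sgn b) (sgn-*-sgn a) ⟩
  1ℤ * sgn b                   ≡⟨ ℤₚ.*-identityˡ (sgn b) ⟩
  sgn b                        ∎
  where
  pair-up : ∀ x y → x * y * x ≡ (x * x) * y
  pair-up = solve-∀

sgnℤ-pred : ∀ j → sgnℤ (j - 1ℤ) ≡ - sgnℤ j
sgnℤ-pred (+ zero) = refl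
sgnℤ-pred (+ suc k) = sym (ℤₚ.neg-involutive (sgn k))
sgnℤ-pred -[1+ k ] = cong (λ z → - - sgn z) (ℕₚ.+-identityʳ k)

private
  zero-minus-zero : ∀ c → 0ℤ - c * 0ℤ ≡ 0ℤ
  zero-minus-zero = solve-∀

stirling1-vanish : ∀ {n k} → n < k → stirling1 n k ≡ 0ℤ
stirling1-vanish {zero} {suc k} _ = refl
stirling1-vanish {suc n} {suc k} (s≤s n<k) = begin
  stirling1 n k - + n * stirling1 n (suc k)  ≡⟨ cong₂ (λ x y → x - + n * y) (stirling1-vanish n<k)
                                                        (stirling1-vanish (ℕₚ.m<n⇒m<1+n n<k)) ⟩
  0ℤ - + n * 0ℤ                              ≡⟨ zero-minus-zero (+ n) ⟩
  0ℤ                                         ∎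

s-suc : ∀ n x → s (suc n) x ≡ s n (x - 1ℤ) - + n * s n x
s-suc n (+ zero) = minus-as-sub (+ n) (stirling1 n 0)
  where
  minus-as-sub : ∀ a y → (- a) * y ≡ 0ℤ - a * y
  minus-as-sub = solve-∀
s-suc n (+ suc m) = refl
s-suc n -[1+ m ] = sym (zero-minus-zero (+ n))

s*s-vanish-apart : ∀ n {d} x y → n < d → x ≡ y + + d → s n x * s n y ≡ 0ℤ
s*s-vanish-apart n {d} x (+ b) n<d refl =
  cong (_* s n (+ b)) (stirling1-vanish (ℕₚ.≤-trans n<d (ℕₚ.m≤n+m d b)))
s*s-vanish-apart n x -[1+ k ] _ _ = ℤₚ.*-zeroʳ (s n x)

s*s-vanish-apart′ : ∀ n {d} x y → n < d → y ≡ x + + d → s n x * s n y ≡ 0ℤ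
s*s-vanish-apart′ n x y n<d eq = trans (ℤₚ.*-comm (s n x) (s n y)) (s*s-vanish-apart n y x n<d eq)

s*s-vanish-negative : ∀ n x y k → x + y ≡ -[1+ k ] → s n x * s n y ≡ 0ℤ
s*s-vanish-negative n -[1+ a ] y k _ = refl
s*s-vanish-negative n (+ a) -[1+ b ] k _ = ℤₚ.*-zeroʳ (s n (+ a))

timesX : (ℕ → ℤ) → ℕ → ℤ
timesX f zero = 0ℤ
timesX f (suc l) = f l

timesX-cong : ∀ {f g : ℕ → ℤ} → (∀ i → f i ≡ g i) → ∀ l → timesX f l ≡ timesX g l
timesX-cong e zero = refl
timesX-cong e (suc l) = e l

u-vanish : ∀ r {n k} → n < k → u r n k ≡ 0ℤ
u-vanish r {zero} {suc k} _ = refl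
u-vanish r {suc n} {suc k} n<k with suc k ℕ.≤ᵇ suc n in eq
... | true = ⊥-elim (ℕₚ.<⇒≱ n<k (ℕₚ.≤ᵇ⇒≤ (suc k) (suc n) (subst T (sym eq) tt)))
... | false = refl

u-suc : ∀ r n l → u r (suc n) l ≡ timesX (u r n) l - + (n ℕ.* n ℕ.+ r) * u r n l
u-suc r n zero = begin
  - sgn n * + (prodSq r n ℕ.* c)          ≡⟨ cong (λ p → - sgn n * p) (ℤₚ.pos-* (prodSq r n) c) ⟩
  - sgn n * (+ prodSq r n * + c)          ≡⟨ reassociate (sgn n) (+ prodSq r n) (+ c) ⟩
  0ℤ - + c * (sgn n * + prodSq r n)       ≡⟨ cong (λ x → 0ℤ - + c * x) (u-zero n) ⟨
  0ℤ - + c * u r n 0                      ∎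
  where
  c : ℕ
  c = n ℕ.* n ℕ.+ r
  reassociate : ∀ e p q → (- e) * (p * q) ≡ 0ℤ - q * (e * p)
  reassociate = solve-∀
  u-zero : ∀ n → u r n 0 ≡ sgn n * + prodSq r n
  u-zero zero = refl
  u-zero (suc n) = refl
u-suc r n (suc l) with suc l ℕ.≤ᵇ suc n in eq
... | true = refl
... | false = sym (begin
  u r n l - + c * u r n (suc l)
    ≡⟨ cong₂ (λ x y → x - + c * y) (u-vanish r n<l) (u-vanish r (ℕₚ.m<n⇒m<1+n n<l)) ⟩
  0ℤ - + c * 0ℤ                  ≡⟨ zero-minus-zero (+ c) ⟩
  0ℤ                             ∎)
  where
  c : ℕ
  c = n ℕ.* n ℕ.+ r
  n<l : n < l
  n<l = ℕₚ.≰⇒> (λ l≤n → subst T eq (ℕₚ.≤⇒≤ᵇ (s≤s l≤n)))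

-- Substituting x - r for x

negPow : ℕ → ℕ → ℤ
negPow r e = sgn e * + (r ℕ.^ e)

negPow-suc : ∀ r e → negPow r (suc e) ≡ (- + r) * negPow r e
negPow-suc r e =
  trans (cong (λ p → - sgn e * p) (ℤₚ.pos-* r (r ℕ.^ e))) (reassociate (sgn e) (+ r) (+ (r ℕ.^ e)))
  where
  reassociate : ∀ a q p → (- a) * (q * p) ≡ (- q) * (a * p)
  reassociate = solve-∀

shiftCoeff : ℕ → ℕ → ℕ → ℤ
shiftCoeff r m l = + (m C l) * negPow r (m ∸ l)

private
  m∸n≡1+[m∸1+n] : ∀ {m n} → n < m → m ∸ n ≡ suc (m ∸ suc n)
  m∸n≡1+[m∸1+n] {suc m} {zero} _ = refl
  m∸n≡1+[m∸1+n] {suc m} {suc n} (s≤s n<m) = m∸n≡1+[m∸1+n] n<m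

binomial-negPow : ∀ r m l →
                  + (m C suc l) * negPow r (m ∸ l) ≡ (- + r) * (+ (m C suc l) * negPow r (m ∸ suc l))
binomial-negPow r m l with l ℕ.<? m
... | yes l<m = begin
  + (m C suc l) * negPow r (m ∸ l)
    ≡⟨ cong (λ e → + (m C suc l) * negPow r e) (m∸n≡1+[m∸1+n] l<m) ⟩
  + (m C suc l) * negPow r (suc (m ∸ suc l))          ≡⟨ cong (+ (m C suc l) *_) (negPow-suc r (m ∸ suc l)) ⟩
  + (m C suc l) * ((- + r) * negPow r (m ∸ suc l))    ≡⟨ swap (+ (m C suc l)) (- + r) (negPow r (m ∸ suc l)) ⟩
  (- + r) * (+ (m C suc l) * negPow r (m ∸ suc l))    ∎
  where
  swap : ∀ a b c → a * (b * c) ≡ b * (a * c)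
  swap = solve-∀
... | no l≮m = begin
  + (m C suc l) * negPow r (m ∸ l)                    ≡⟨ cong (λ c → + c * negPow r (m ∸ l)) vanish ⟩
  0ℤ                                                  ≡⟨ ℤₚ.*-zeroʳ (- + r) ⟨
  (- + r) * 0ℤ
    ≡⟨ cong (λ c → (- + r) * (+ c * negPow r (m ∸ suc l))) vanish ⟨
  (- + r) * (+ (m C suc l) * negPow r (m ∸ suc l))    ∎
  where
  vanish : m C suc l ≡ 0
  vanish = k>n⇒nCk≡0 (s≤s (ℕₚ.≮⇒≥ l≮m))

shiftCoeff-suc : ∀ r m l → shiftCoeff r (suc m) l ≡ timesX (shiftCoeff r m) l + (- + r) * shiftCoeff r m l
shiftCoeff-suc r m zero =
  trans (cong (1ℤ *_) (negPow-suc r m)) (reassociate (- + r) (negPow r m))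
  where
  reassociate : ∀ q p → 1ℤ * (q * p) ≡ 0ℤ + q * (1ℤ * p)
  reassociate = solve-∀
shiftCoeff-suc r m (suc l) = begin
  + (suc m C suc l) * negPow r (m ∸ l)
    ≡⟨ cong (λ c → + c * negPow r (m ∸ l)) (nCk+nC[k+1]≡[n+1]C[k+1] m l) ⟨
  + (m C l ℕ.+ m C suc l) * negPow r (m ∸ l)
    ≡⟨ cong (_* negPow r (m ∸ l)) (ℤₚ.pos-+ (m C l) (m C suc l)) ⟩
  (+ (m C l) + + (m C suc l)) * negPow r (m ∸ l)
    ≡⟨ ℤₚ.*-distribʳ-+ (negPow r (m ∸ l)) (+ (m C l)) (+ (m C suc l)) ⟩
  shiftCoeff r m l + + (m C suc l) * negPow r (m ∸ l)
    ≡⟨ cong (λ t → shiftCoeff r m l + t) (binomial-negPow r m l) ⟩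
  shiftCoeff r m l + (- + r) * shiftCoeff r m (suc l) ∎

shiftCoeff-vanish : ∀ r {m l} → m < l → shiftCoeff r m l ≡ 0ℤ
shiftCoeff-vanish r {m} {l} m<l = cong (λ c → + c * negPow r (m ∸ l)) (k>n⇒nCk≡0 m<l)

shiftCoeff-symmetric : ∀ r {m l} → l ≤ m → shiftCoeff r m l ≡ + (m C (m ∸ l)) * negPow r (m ∸ l)
shiftCoeff-symmetric r {m} {l} l≤m = cong (λ c → + c * negPow r (m ∸ l)) (nCk≡nC[n∸k] l≤m)

-- translate r N f lists the coefficients of p(x - r), where p(x) = Σ_{m ≤ N} f m x^m
translate : ℕ → ℕ → (ℕ → ℤ) → ℕ → ℤ
translate r N f l = Σ≤ N (λ m → shiftCoeff r m l * f m)

translate-cong : ∀ r N {f g : ℕ → ℤ} → (∀ m → f m ≡ g m) → ∀ l →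
                 translate r N f l ≡ translate r N g l
translate-cong r N e l = Σ≤-cong N (λ m → cong (shiftCoeff r m l *_) (e m))

translate-linear : ∀ r N c (f g : ℕ → ℤ) l →
                   translate r N (λ m → f m - c * g m) l ≡ translate r N f l - c * translate r N g l
translate-linear r N c f g l = begin
  Σ≤ N (λ m → shiftCoeff r m l * (f m - c * g m))
    ≡⟨ Σ≤-cong N (λ m → distribute (shiftCoeff r m l) (f m) (g m) c) ⟩
  Σ≤ N (λ m → shiftCoeff r m l * f m + (- c) * (shiftCoeff r m l * g m))
    ≡⟨ Σ≤-linear N (- c) (λ m → shiftCoeff r m l * f m) (λ m → shiftCoeff r m l * g m) ⟩
  translate r N f l + (- c) * translate r N g l
    ≡⟨ cong (λ t → translate r N f l + t) (ℤₚ.neg-distribˡ-* c (translate r N g l)) ⟨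
  translate r N f l - c * translate r N g l ∎
  where
  distribute : ∀ a x y c → a * (x - c * y) ≡ a * x + (- c) * (a * y)
  distribute = solve-∀

Σ≤-timesX : ∀ N (g : ℕ → ℕ → ℤ) (f : ℕ → ℤ) l →
            Σ≤ N (λ m → timesX (g m) l * f m) ≡ timesX (λ l → Σ≤ N (λ m → g m l * f m)) l
Σ≤-timesX N g f zero = Σ≤-zero N (λ m → ℤₚ.*-zeroˡ (f m))
Σ≤-timesX N g f (suc l) = refl

Σ≤-timesX-reindex : ∀ N (g f : ℕ → ℤ) → f N ≡ 0ℤ →
                    Σ≤ N (λ m → g m * timesX f m) ≡ Σ≤ N (λ m → g (suc m) * f m)
Σ≤-timesX-reindex zero g f f0≡0 =
  trans (ℤₚ.*-zeroʳ (g 0)) (sym (trans (cong (g 1 *_) f0≡0) (ℤₚ.*-zeroʳ (g 1))))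
Σ≤-timesX-reindex (suc N) g f fN≡0 = begin
  Σ≤ (suc N) (λ m → g m * timesX f m)         ≡⟨ Σ≤-unfoldˡ N (λ m → g m * timesX f m) ⟩
  g 0 * 0ℤ + S                                ≡⟨ cong (_+ S) (ℤₚ.*-zeroʳ (g 0)) ⟩
  0ℤ + S                                      ≡⟨ ℤₚ.+-identityˡ S ⟩
  S                                           ≡⟨ ℤₚ.+-identityʳ S ⟨
  S + 0ℤ                                      ≡⟨ cong (λ t → S + t) (ℤₚ.*-zeroʳ (g (suc (suc N)))) ⟨
  S + g (suc (suc N)) * 0ℤ                    ≡⟨ cong (λ t → S + g (suc (suc N)) * t) fN≡0 ⟨
  Σ≤ (suc N) (λ m → g (suc m) * f m)          ∎
  where
  S : ℤ
  S = Σ≤ N (λ m → g (suc m) * f m)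

translate-timesX : ∀ r N (f : ℕ → ℤ) → f N ≡ 0ℤ → ∀ l →
                   translate r N (timesX f) l ≡ timesX (translate r N f) l + (- + r) * translate r N f l
translate-timesX r N f fN≡0 l = begin
  Σ≤ N (λ m → shiftCoeff r m l * timesX f m)
    ≡⟨ Σ≤-timesX-reindex N (λ m → shiftCoeff r m l) f fN≡0 ⟩
  Σ≤ N (λ m → shiftCoeff r (suc m) l * f m)
    ≡⟨ Σ≤-cong N (λ m → trans (cong (_* f m) (shiftCoeff-suc r m l))
                               (distribute (timesX (shiftCoeff r m) l) (shiftCoeff r m l) (f m) (- + r))) ⟩
  Σ≤ N (λ m → timesX (shiftCoeff r m) l * f m + (- + r) * (shiftCoeff r m l * f m))
    ≡⟨ Σ≤-linear N (- + r) (λ m → timesX (shiftCoeff r m) l * f m) (λ m → shiftCoeff r m l * f m) ⟩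
  Σ≤ N (λ m → timesX (shiftCoeff r m) l * f m) + (- + r) * translate r N f l
    ≡⟨ cong (_+ (- + r) * translate r N f l) (Σ≤-timesX N (shiftCoeff r) f l) ⟩
  timesX (translate r N f) l + (- + r) * translate r N f l ∎
  where
  distribute : ∀ a b x q → (a + q * b) * x ≡ a * x + q * (b * x)
  distribute = solve-∀

u-translate : ∀ r {n} N → n ≤ N → ∀ l → u r n l ≡ translate r N (u 0 n) l
u-translate r {zero} N _ l = sym (begin
  translate r N (u 0 0) l
    ≡⟨ Σ≤-vanishing-tail N _ z≤n (λ m 0<m _ → trans (cong (shiftCoeff r m l *_) (u-vanish 0 0<m))
                                                    (ℤₚ.*-zeroʳ (shiftCoeff r m l))) ⟩
  shiftCoeff r 0 l * 1ℤ     ≡⟨ constant l ⟩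
  u r 0 l                   ∎)
  where
  constant : ∀ l → shiftCoeff r 0 l * 1ℤ ≡ u r 0 l
  constant zero = refl
  constant (suc l) = refl
u-translate r {suc n} N n<N l = begin
  u r (suc n) l                                   ≡⟨ u-suc r n l ⟩
  timesX (u r n) l - + (n ℕ.* n ℕ.+ r) * u r n l
                                  ≡⟨ cong₂ (λ x y → x - + (n ℕ.* n ℕ.+ r) * y) (timesX-cong IH l) (IH l) ⟩
  timesX p l - + (n ℕ.* n ℕ.+ r) * p l            ≡⟨ cong (λ a → timesX p l - a * p l) split-coefficient ⟩
  timesX p l - (c₀ + + r) * p l                   ≡⟨ regroup (timesX p l) (p l) c₀ (+ r) ⟩
  (timesX p l + (- + r) * p l) - c₀ * p l
                                  ≡⟨ cong (_- c₀ * p l) (translate-timesX r N (u 0 n) (u-vanish 0 n<N) l) ⟨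
  translate r N (timesX (u 0 n)) l - c₀ * p l     ≡⟨ translate-linear r N c₀ (timesX (u 0 n)) (u 0 n) l ⟨
  translate r N (λ m → timesX (u 0 n) m - c₀ * u 0 n m) l
                                                  ≡⟨ translate-cong r N (λ m → u-suc 0 n m) l ⟨
  translate r N (u 0 (suc n)) l                   ∎
  where
  IH : ∀ l → u r n l ≡ translate r N (u 0 n) l
  IH = u-translate r N (ℕₚ.<⇒≤ n<N)
  p : ℕ → ℤ
  p = translate r N (u 0 n)
  c₀ : ℤ
  c₀ = + (n ℕ.* n ℕ.+ 0)
  split-coefficient : + (n ℕ.* n ℕ.+ r) ≡ c₀ + + r
  split-coefficient = trans (cong (λ z → + (z ℕ.+ r)) (sym (ℕₚ.+-identityʳ (n ℕ.* n))))
                            (ℤₚ.pos-+ (n ℕ.* n ℕ.+ 0) r)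
  regroup : ∀ x t a q → x - (a + q) * t ≡ (x + (- q) * t) - a * t
  regroup = solve-∀

-- The case r = 0

signedPair : ℕ → ℤ → ℤ → ℤ
signedPair n m j = sgnℤ j * (s n (m + j) * s n (m - j))

signedPairSum : ℕ → ℤ → ℤ
signedPairSum n m = Σsym n (signedPair n m)

crossPair : ℕ → ℤ → ℤ → ℤ
crossPair n m j = sgnℤ j * (s n (m + j) * s n (m - 1ℤ - j))

private
  scaled-zero : ∀ g {x} → x ≡ 0ℤ → g * x ≡ 0ℤ
  scaled-zero g refl = ℤₚ.*-zeroʳ g

  n<1+w+w : ∀ {n w} → n ≤ w → n < suc (w ℕ.+ w)
  n<1+w+w n≤w = s≤s (ℕₚ.≤-trans n≤w (ℕₚ.m≤m+n _ _))

signedPair-vanishʳ : ∀ n m {w} → n ≤ w → signedPair n m (+ suc w) ≡ 0ℤ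
signedPair-vanishʳ n m {w} n≤w =
  scaled-zero (sgnℤ (+ suc w))
    (s*s-vanish-apart n (m + + suc w) (m - + suc w) (ℕₚ.m<n⇒m<1+n (n<1+w+w n≤w)) (gap m (+ w)))
  where
  gap : ∀ m a → m + (1ℤ + a) ≡ (m - (1ℤ + a)) + (1ℤ + (1ℤ + (a + a)))
  gap = solve-∀

signedPair-vanishˡ : ∀ n m {w} → n ≤ w → signedPair n m -[1+ w ] ≡ 0ℤ
signedPair-vanishˡ n m {w} n≤w =
  scaled-zero (sgnℤ -[1+ w ])
    (s*s-vanish-apart′ n (m + -[1+ w ]) (m - -[1+ w ]) (ℕₚ.m<n⇒m<1+n (n<1+w+w n≤w)) (gap m (+ w)))
  where
  gap : ∀ m a → m - (- (1ℤ + a)) ≡ (m + (- (1ℤ + a))) + (1ℤ + (1ℤ + (a + a)))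
  gap = solve-∀

crossPair-vanishʳ : ∀ n m {w} → n ≤ w → crossPair n m (+ w) ≡ 0ℤ
crossPair-vanishʳ n m {w} n≤w =
  scaled-zero (sgnℤ (+ w)) (s*s-vanish-apart n (m + + w) (m - 1ℤ - + w) (n<1+w+w n≤w) (gap m (+ w)))
  where
  gap : ∀ m a → m + a ≡ ((m - 1ℤ) - a) + (1ℤ + (a + a))
  gap = solve-∀

crossPair-vanishˡ : ∀ n m {w} → n ≤ w → crossPair n m -[1+ w ] ≡ 0ℤ
crossPair-vanishˡ n m {w} n≤w =
  scaled-zero (sgnℤ -[1+ w ])
    (s*s-vanish-apart′ n (m + -[1+ w ]) (m - 1ℤ - -[1+ w ]) (n<1+w+w n≤w) (gap m (+ w)))
  where
  gap : ∀ m a → (m - 1ℤ) - (- (1ℤ + a)) ≡ (m + (- (1ℤ + a))) + (1ℤ + (a + a))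
  gap = solve-∀

signedPairSum-negative : ∀ n k → signedPairSum n -[1+ k ] ≡ 0ℤ
signedPairSum-negative n k = Σ≤-zero (n ℕ.+ n) (λ t → scaled-zero (sgnℤ (j t))
  (s*s-vanish-negative n (-[1+ k ] + j t) (-[1+ k ] - j t) (suc (k ℕ.+ k)) (sum-args -[1+ k ] (j t))))
  where
  j : ℕ → ℤ
  j t = + t - + n
  sum-args : ∀ m j → (m + j) + (m - j) ≡ m + m
  sum-args = solve-∀

signedPair-suc : ∀ n m j →
  signedPair (suc n) m j ≡
    (signedPair n (m - 1ℤ) j + (+ n * + n) * signedPair n m j)
      + (- + n) * (crossPair n m j - crossPair n m (j - 1ℤ))
signedPair-suc n m j = begin
  g * (s (suc n) (m + j) * s (suc n) (m - j))
    ≡⟨ cong₂ (λ x y → g * (x * y)) (s-suc′ (m + j) (pred-plus m j)) (s-suc′ (m - j) (pred-minus m j)) ⟩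
  g * ((a - + n * b) * (c - + n * d))
    ≡⟨ expand g a b c d (+ n) ⟩
  (g * (a * c) + (+ n * + n) * (g * (b * d))) + (- + n) * (g * (b * c) - (- g) * (a * d))
    ≡⟨ cong (λ t → (g * (a * c) + (+ n * + n) * (g * (b * d))) + (- + n) * (g * (b * c) - t))
            (sym shifted-cross) ⟩
  (signedPair n (m - 1ℤ) j + (+ n * + n) * signedPair n m j)
    + (- + n) * (crossPair n m j - crossPair n m (j - 1ℤ))                                ∎
  where
  g a b c d : ℤ
  g = sgnℤ j
  a = s n (m - 1ℤ + j)
  b = s n (m + j)
  c = s n (m - 1ℤ - j)
  d = s n (m - j)
  s-suc′ : ∀ x {y} → x - 1ℤ ≡ y → s (suc n) x ≡ s n y - + n * s n x
  s-suc′ x eq = trans (s-suc n x) (cong (λ z → s n z - + n * s n x) eq)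
  pred-plus : ∀ m j → m + j - 1ℤ ≡ m - 1ℤ + j
  pred-plus = solve-∀
  pred-minus : ∀ m j → m - j - 1ℤ ≡ m - 1ℤ - j
  pred-minus = solve-∀
  expand : ∀ g a b c d q → g * ((a - q * b) * (c - q * d)) ≡
           (g * (a * c) + (q * q) * (g * (b * d))) + (- q) * (g * (b * c) - (- g) * (a * d))
  expand = solve-∀
  plus-pred : ∀ m j → m + (j - 1ℤ) ≡ m - 1ℤ + j
  plus-pred = solve-∀
  minus-pred : ∀ m j → m - 1ℤ - (j - 1ℤ) ≡ m - j
  minus-pred = solve-∀
  shifted-cross : crossPair n m (j - 1ℤ) ≡ (- g) * (a * d)
  shifted-cross =
    trans (cong₂ (λ σ x → σ * (x * s n (m - 1ℤ - (j - 1ℤ)))) (sgnℤ-pred j) (cong (s n) (plus-pred m j)))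
          (cong (λ y → (- g) * (a * s n y)) (minus-pred m j))

signedPairSum-suc : ∀ n m →
                    signedPairSum (suc n) m ≡ signedPairSum n (m - 1ℤ) + (+ n * + n) * signedPairSum n m
signedPairSum-suc n m = begin
  Σsym (suc n) (signedPair (suc n) m)
    ≡⟨ Σsym-cong (suc n) (signedPair-suc n m) ⟩
  Σsym (suc n) (λ j → (P₋ j + q * P j) + (- + n) * cross j)
    ≡⟨ Σsym-linear (suc n) (- + n) (λ j → P₋ j + q * P j) cross ⟩
  Σsym (suc n) (λ j → P₋ j + q * P j) + (- + n) * Σsym (suc n) cross
    ≡⟨ cong₂ (λ x y → x + (- + n) * y) (Σsym-linear (suc n) q P₋ P) (Σsym-telescope (suc n) (crossPair n m)) ⟩
  (Σsym (suc n) P₋ + q * Σsym (suc n) P) + (- + n) * (crossPair n m (+ suc n) - crossPair n m -[1+ suc n ])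
    ≡⟨ cong₂ (λ x y → x + (- + n) * y) (cong₂ (λ x y → x + q * y) (narrow (m - 1ℤ)) (narrow m)) endpoints ⟩
  (signedPairSum n (m - 1ℤ) + q * signedPairSum n m) + (- + n) * 0ℤ
    ≡⟨ drop-zero (signedPairSum n (m - 1ℤ) + q * signedPairSum n m) (- + n) ⟩
  signedPairSum n (m - 1ℤ) + q * signedPairSum n m ∎
  where
  P₋ P cross : ℤ → ℤ
  P₋ = signedPair n (m - 1ℤ)
  P = signedPair n m
  cross j = crossPair n m j - crossPair n m (j - 1ℤ)
  q : ℤ
  q = + n * + n
  narrow : ∀ x → Σsym (suc n) (signedPair n x) ≡ signedPairSum n x
  narrow x = Σsym-narrow (suc n) (signedPair n x) (ℕₚ.n≤1+n n)
               (λ v n≤v → signedPair-vanishˡ n x n≤v) (λ v n≤v → signedPair-vanishʳ n x n≤v)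
  endpoints : crossPair n m (+ suc n) - crossPair n m -[1+ suc n ] ≡ 0ℤ
  endpoints = cong₂ _-_ (crossPair-vanishʳ n m (ℕₚ.n≤1+n n)) (crossPair-vanishˡ n m (ℕₚ.n≤1+n n))
  drop-zero : ∀ x q → x + q * 0ℤ ≡ x
  drop-zero = solve-∀

u₀-signedPairSum : ∀ n l → u 0 n l ≡ sgn (n ℕ.+ l) * signedPairSum n (+ l)
u₀-signedPairSum zero zero = refl
u₀-signedPairSum zero (suc l) = sym (ℤₚ.*-zeroʳ (sgn (suc l)))
u₀-signedPairSum (suc n) l = begin
  u 0 (suc n) l                                  ≡⟨ u-suc 0 n l ⟩
  timesX (u 0 n) l - c₀ * u 0 n l                ≡⟨ cong₂ (λ x y → x - c₀ * y) (timesX-cong IH l) (IH l) ⟩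
  timesX W l - c₀ * W l                          ≡⟨ cong₂ (λ x c → x - c * W l) (timesX-W l) c₀≡n*n ⟩
  - σ * V (+ l - 1ℤ) - (+ n * + n) * (σ * V (+ l))
                                                 ≡⟨ factor σ (V (+ l - 1ℤ)) (V (+ l)) (+ n * + n) ⟩
  - σ * (V (+ l - 1ℤ) + (+ n * + n) * V (+ l))   ≡⟨ cong (- σ *_) (signedPairSum-suc n (+ l)) ⟨
  - σ * signedPairSum (suc n) (+ l)              ∎
  where
  IH : ∀ l → u 0 n l ≡ sgn (n ℕ.+ l) * signedPairSum n (+ l)
  IH = u₀-signedPairSum n
  V : ℤ → ℤ
  V = signedPairSum n
  W : ℕ → ℤ
  W l = sgn (n ℕ.+ l) * V (+ l)
  σ : ℤ
  σ = sgn (n ℕ.+ l)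
  c₀ : ℤ
  c₀ = + (n ℕ.* n ℕ.+ 0)
  c₀≡n*n : c₀ ≡ + n * + n
  c₀≡n*n = trans (cong +_ (ℕₚ.+-identityʳ (n ℕ.* n))) (ℤₚ.pos-* n n)
  timesX-W : ∀ l → timesX W l ≡ - sgn (n ℕ.+ l) * V (+ l - 1ℤ)
  timesX-W zero = sym (trans (cong (- sgn (n ℕ.+ 0) *_) (signedPairSum-negative n 0))
                             (ℤₚ.*-zeroʳ (- sgn (n ℕ.+ 0))))
  timesX-W (suc l) = cong (λ e → e * V (+ l)) (trans (sym (ℤₚ.neg-involutive (sgn (n ℕ.+ l))))
                                                    (cong (λ k → - sgn k) (sym (ℕₚ.+-suc n l))))
  factor : ∀ σ x y q → (- σ) * x - q * (σ * y) ≡ (- σ) * (x + q * y)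
  factor = solve-∀

signedPairSum-narrow : ∀ {n i} → i ≤ n → signedPairSum n (+ (n ∸ i)) ≡ Σsym i (signedPair n (+ (n ∸ i)))
signedPairSum-narrow {n} {i} i≤n = Σsym-narrow n (signedPair n M) i≤n
  (λ w i≤w → scaled-zero (sgnℤ -[1+ w ]) (trans (ℤₚ.*-comm (s n (M + -[1+ w ])) _)
                                                 (cong (_* s n (M + -[1+ w ])) (beyond i≤w))))
  (λ w i≤w → scaled-zero (sgnℤ (+ suc w)) (cong (_* s n (M - + suc w)) (beyond i≤w)))
  where
  M : ℤ
  M = + (n ∸ i)
  beyond : ∀ {w} → i ≤ w → stirling1 n ((n ∸ i) ℕ.+ suc w) ≡ 0ℤ
  beyond {w} i≤w = stirling1-vanish
    (subst (_< (n ∸ i) ℕ.+ suc w) (ℕₚ.m∸n+n≡m i≤n) (ℕₚ.+-monoʳ-< (n ∸ i) (s≤s i≤w)))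

reversed-summand : ∀ r {n k i} → i ≤ k → k ≤ n →
  shiftCoeff r (n ∸ i) (n ∸ k) * (sgn (n ℕ.+ (n ∸ i)) * signedPairSum n (+ (n ∸ i))) ≡
  Σsym i (λ j → sgn k * sgnℤ j * (+ ((n ∸ i) C (k ∸ i)))
                  * s n (+ (n ∸ i) + j) * s n (+ (n ∸ i) - j) * (+ (r ℕ.^ (k ∸ i))))
reversed-summand r {n} {k} {i} i≤k k≤n = begin
  shiftCoeff r A (n ∸ k) * (sgn (n ℕ.+ A) * signedPairSum n (+ A))
    ≡⟨ cong₂ (λ x y → x * (sgn (y ℕ.+ A) * signedPairSum n (+ A))) coeff (sym (ℕₚ.m∸n+n≡m i≤n)) ⟩
  (+ (A C e) * negPow r e) * (sgn (A ℕ.+ i ℕ.+ A) * signedPairSum n (+ A))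
    ≡⟨ cong₂ (λ x y → (+ (A C e) * negPow r e) * (x * y)) (sgn-+-twice A i) (signedPairSum-narrow i≤n) ⟩
  (+ (A C e) * (sgn e * ρ)) * (sgn i * Σsym i (signedPair n (+ A)))
    ≡⟨ regroup (+ (A C e)) (sgn e) ρ (sgn i) (Σsym i (signedPair n (+ A))) ⟩
  (sgn e * sgn i * + (A C e) * ρ) * Σsym i (signedPair n (+ A))
    ≡⟨ cong (λ x → (x * + (A C e) * ρ) * Σsym i (signedPair n (+ A)))
            (trans (sym (sgn-+ e i)) (cong sgn (ℕₚ.m∸n+n≡m i≤k))) ⟩
  (sgn k * + (A C e) * ρ) * Σsym i (signedPair n (+ A))
    ≡⟨ Σsym-*ˡ i (sgn k * + (A C e) * ρ) (signedPair n (+ A)) ⟨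
  Σsym i (λ j → (sgn k * + (A C e) * ρ) * signedPair n (+ A) j)
    ≡⟨ Σsym-cong i (λ j → spread (sgn k) (+ (A C e)) ρ (sgnℤ j) (s n (+ A + j)) (s n (+ A - j))) ⟩
  Σsym i (λ j → sgn k * sgnℤ j * + (A C e) * s n (+ A + j) * s n (+ A - j) * ρ) ∎
  where
  A e : ℕ
  A = n ∸ i
  e = k ∸ i
  ρ : ℤ
  ρ = + (r ℕ.^ e)
  i≤n : i ≤ n
  i≤n = ℕₚ.≤-trans i≤k k≤n
  A∸[n∸k]≡e : A ∸ (n ∸ k) ≡ e
  A∸[n∸k]≡e = begin
    (n ∸ i) ∸ (n ∸ k)                     ≡⟨ cong (λ z → z ∸ i ∸ (n ∸ k)) (ℕₚ.m∸n+n≡m k≤n) ⟨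
    ((n ∸ k) ℕ.+ k) ∸ i ∸ (n ∸ k)         ≡⟨ cong (_∸ (n ∸ k)) (ℕₚ.+-∸-assoc (n ∸ k) i≤k) ⟩
    ((n ∸ k) ℕ.+ (k ∸ i)) ∸ (n ∸ k)       ≡⟨ ℕₚ.m+n∸m≡n (n ∸ k) (k ∸ i) ⟩
    k ∸ i                                 ∎
  coeff : shiftCoeff r A (n ∸ k) ≡ + (A C e) * negPow r e
  coeff = trans (shiftCoeff-symmetric r (ℕₚ.∸-monoʳ-≤ n i≤k))
                (cong (λ d → + (A C d) * negPow r d) A∸[n∸k]≡e)
  regroup : ∀ c σ ρ τ S → (c * (σ * ρ)) * (τ * S) ≡ (σ * τ * c * ρ) * S
  regroup = solve-∀
  spread : ∀ κ c ρ g x y → (κ * c * ρ) * (g * (x * y)) ≡ κ * g * c * x * y * ρ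
  spread = solve-∀

mainTheorem8 : (r n k : ℕ) → k ≤ n → u r n (n ∸ k) ≡ rhs r n k
mainTheorem8 r n k k≤n = begin
  u r n (n ∸ k)                    ≡⟨ u-translate r n ℕₚ.≤-refl (n ∸ k) ⟩
  translate r n (u 0 n) (n ∸ k)    ≡⟨ translate-cong r n (u₀-signedPairSum n) (n ∸ k) ⟩
  Σ≤ n summand                     ≡⟨ Σ≤-reverse n summand ⟩
  Σ≤ n (λ i → summand (n ∸ i))     ≡⟨ Σ≤-vanishing-tail n _ k≤n tail-vanishes ⟩
  Σ≤ k (λ i → summand (n ∸ i))     ≡⟨ Σ≤-cong-≤ k (λ i i≤k → reversed-summand r i≤k k≤n) ⟩
  rhs r n k                        ∎
  where
  summand : ℕ → ℤ
  summand m = shiftCoeff r m (n ∸ k) * (sgn (n ℕ.+ m) * signedPairSum n (+ m))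
  tail-vanishes : ∀ i → k < i → i ≤ n → summand (n ∸ i) ≡ 0ℤ
  tail-vanishes i k<i i≤n = trans (cong (_* (sgn (n ℕ.+ (n ∸ i)) * signedPairSum n (+ (n ∸ i))))
                                        (shiftCoeff-vanish r (ℕₚ.∸-monoʳ-< k<i i≤n)))
                                  (ℤₚ.*-zeroˡ (sgn (n ℕ.+ (n ∸ i)) * signedPairSum n (+ (n ∸ i))))
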